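{- The maximum possible terminal Mostar index $\mathrm{Mo}^{\top}(G)$ among all bipartite graphs $G$ of order $n$ is $\frac{n^3}{27}(1\pm o(1))$ as $n\to\infty$.
   Context: A pendent vertex is a vertex of degree $1$. For a graph $G$ and an edge $\{u,v\}\in E(G)$, let $\ell_G(u,v)$ be the number of pendent vertices of $G$ that are strictly closer to $u$ than to $v$. The terminal Mostar index is $\mathrm{Mo}^{\top}(G)=\sum_{\{u,v\}\in E(G)}|\ell_G(u,v)-\ell_G(v,u)|$. -}

module Defs where

open import Data.Bool using (Bool; true; false; _∧_; _∨_; not; if_then_else_)
open import Data.Nat using (ℕ; zero; suc; _+_; _*_; _<ᵇ_; _≡ᵇ_; ∣_-_∣)
open import Data.Fin using (Fin; _≟_; toℕ)
open import Data.List using (List; []; _∷_; map; allFin; upTo)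
open import Data.Nat.ListAction using (sum)
open import Data.Bool.ListAction using (any)
open import Data.Maybe using (Maybe; just; nothing)
open import Data.Product using (Σ; ∃)
open import Relation.Binary.PropositionalEquality using (_≡_; _≢_)
open import Relation.Nullary using (¬_)
open import Relation.Nullary.Decidable using (⌊_⌋)

record Graph (n : ℕ) : Set where
  field
    adj     : Fin n → Fin n → Bool
    symm    : ∀ u v → adj u v ≡ adj v u
    irrefl  : ∀ u → adj u u ≡ false

open Graph public

module _ {n : ℕ} (G : Graph n) where

  countV : (Fin n → Bool) → ℕ
  countV p = sum (map (λ x → if p x then 1 else 0) (allFin n))

  degree : Fin n → ℕ
  degree u = countV (adj G u)

  isPendent : Fin n → Bool
  isPendent u = degree u ≡ᵇ 1

  reach : ℕ → Fin n → Fin n → Bool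
  reach zero    u w = ⌊ u ≟ w ⌋
  reach (suc k) u w = reach k u w ∨ any (λ x → reach k u x ∧ adj G x w) (allFin n)

  firstReach : Fin n → Fin n → List ℕ → Maybe ℕ
  firstReach u w []       = nothing
  firstReach u w (k ∷ ks) = if reach k u w then just k else firstReach u w ks

  -- graph distance d(u,w); nothing = infinite (no path).
  -- A shortest path has length < n, so trying lengths 0..n-1 suffices.
  dist : Fin n → Fin n → Maybe ℕ
  dist u w = firstReach u w (upTo n)

  strictlyCloser : Fin n → Fin n → Fin n → Bool
  strictlyCloser w u v with dist w u | dist w v
  ... | nothing | _       = false
  ... | just a  | nothing = true
  ... | just a  | just b  = a <ᵇ b

  ℓ : Fin n → Fin n → ℕ
  ℓ u v = countV (λ w → isPendent w ∧ strictlyCloser w u v)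

  edgeTerm : Fin n → Fin n → ℕ
  edgeTerm u v = if adj G u v ∧ (toℕ u <ᵇ toℕ v) then ∣ ℓ u v - ℓ v u ∣ else 0

  MoT : ℕ
  MoT = sum (map (λ u → sum (map (λ v → edgeTerm u v) (allFin n))) (allFin n))

  Connected : Set
  Connected = ∀ u v → dist u v ≢ nothing

  Bipartite : Set
  Bipartite = Σ (Fin n → Bool) λ c → ∀ u v → adj G u v ≡ true → c u ≢ c v

-- Upper bound: each edge contributes |ℓ(u,v) − ℓ(v,u)| ≤ p, the number of pendent vertices.
-- A pendent vertex lies on a single edge, and every other edge joins the two colour classes
-- of non-pendent vertices, of sizes a and b; with p + a + b = n this gives
-- Mo(G) ≤ p(p + ab) ≤ n² + n³/27 by AM-GM.
-- Lower bound: take K_{t,t} with t = ⌊n/3⌋ and hang the remaining n − 2t ≥ t vertices as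
-- leaves from one vertex (the hub) of the first side.  On every edge of K_{t,t} all leaves
-- are strictly closer to the same endpoint, so each of the t² edges contributes n − 2t ≥ t.

module Submission where

open import Defs
open import Data.Nat using (ℕ; zero; suc; _+_; _*_; _^_; _≤_; _≥_; _<_; z≤n; s≤s; z<s; _<ᵇ_; _≡ᵇ_; ∣_-_∣; _<?_)
open import Data.Nat.Properties
open import Data.Nat.DivMod using (_/_; _%_; m≡m%n+[m/n]*n; m%n<n; m/n*n≤m)
open import Data.Nat.Tactic.RingSolver using (solve-∀)
import Data.Nat.ListAction as List
open import Algebra.Properties.Semiring.Sum +-*-semiring
  using (sum; sum-syntax; sum-cong-≗; sum-replicate-zero; ∑-comm; ∑-distrib-+; *-distribˡ-sum; *-distribʳ-sum)
open import Data.Bool using (Bool; true; false; _∧_; not; if_then_else_; T)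
open import Data.Bool.Properties using (T-∧; T-∨; T-≡)
open import Data.Unit using (tt)
open import Data.Empty using (⊥-elim)
open import Data.Maybe using (just; nothing)
open import Data.Fin using (Fin; toℕ; fromℕ<) renaming (zero to fzero; suc to fsuc)
open import Data.Fin.Properties using (toℕ-fromℕ<; toℕ-injective)
open import Data.List using (map; allFin; tabulate; applyUpTo)
open import Data.List.Properties using (map-tabulate)
open import Data.List.Membership.Propositional using (lose)
open import Data.List.Membership.Propositional.Properties using (∈-allFin)
open import Data.List.Relation.Unary.Any using (satisfied)
open import Data.List.Relation.Unary.Any.Properties using (any⁺; any⁻)
open import Data.Product using (Σ; ∃; _×_; _,_)
open import Data.Sum using (_⊎_; inj₁; inj₂)
open import Function using (_∘_; id; case_of_)
open import Function.Bundles using (Equivalence)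
open import Relation.Binary.PropositionalEquality hiding ([_])
open import Relation.Nullary using (¬_; yes; no; contradiction)
open import Relation.Nullary.Decidable using (fromWitness; toWitness)

[_] : Bool → ℕ
[ b ] = if b then 1 else 0

[∧]≤[] : ∀ a b → [ a ∧ b ] ≤ [ a ]
[∧]≤[] false b     = z≤n
[∧]≤[] true  false = z≤n
[∧]≤[] true  true  = ≤-refl

[∧]≡[] : ∀ a b → (T a → T b) → [ a ∧ b ] ≡ [ a ]
[∧]≡[] false b     _ = refl
[∧]≡[] true  true  _ = refl
[∧]≡[] true  false h = ⊥-elim (h tt)

[∧]≡0 : ∀ a b → (T a → ¬ T b) → [ a ∧ b ] ≡ 0
[∧]≡0 false b     _ = refl
[∧]≡0 true  false _ = refl
[∧]≡0 true  true  h = ⊥-elim (h tt tt)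

¬T⇒≡false : ∀ {b} → ¬ T b → b ≡ false
¬T⇒≡false {false} _ = refl
¬T⇒≡false {true}  h = ⊥-elim (h tt)

sum-tabulate : ∀ n (f : Fin n → ℕ) → List.sum (tabulate f) ≡ ∑[ i < n ] f i
sum-tabulate zero    f = refl
sum-tabulate (suc n) f = cong (f fzero +_) (sum-tabulate n (f ∘ fsuc))

sum-map-allFin : ∀ n (f : Fin n → ℕ) → List.sum (map f (allFin n)) ≡ ∑[ i < n ] f i
sum-map-allFin n f = trans (cong List.sum (map-tabulate id f)) (sum-tabulate n f)

∑-mono-≤ : ∀ {n} {f g : Fin n → ℕ} → (∀ i → f i ≤ g i) → ∑[ i < n ] f i ≤ ∑[ i < n ] g i
∑-mono-≤ {zero}  f≤g = z≤n
∑-mono-≤ {suc n} f≤g = +-mono-≤ (f≤g fzero) (∑-mono-≤ (f≤g ∘ fsuc))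

∑-one : ∀ n → ∑[ i < n ] 1 ≡ n
∑-one zero    = refl
∑-one (suc n) = cong suc (∑-one n)

∑-interval : ∀ n s m (h : ℕ → ℕ) → s + m ≤ n → (∀ i → s ≤ i → i < s + m → 1 ≤ h i) →
  m ≤ ∑[ i < n ] h (toℕ i)
∑-interval n       s       zero    h _ _ = z≤n
∑-interval zero    s       (suc m) h le _ = contradiction (≤-trans (m≤n+m (suc m) s) le) λ ()
∑-interval (suc n) zero    (suc m) h (s≤s le) h≥1 =
  +-mono-≤ (h≥1 0 z≤n z<s) (∑-interval n 0 m (h ∘ suc) le (λ i _ i<m → h≥1 (suc i) z≤n (s≤s i<m)))
∑-interval (suc n) (suc s) m       h (s≤s le) h≥1 =
  ≤-trans (∑-interval n s m (h ∘ suc) le (λ i s≤i i<s+m → h≥1 (suc i) (s≤s s≤i) (s≤s i<s+m))) (m≤n+m _ (h 0))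

∑₂ : ∀ {n} → (Fin n → Fin n → ℕ) → ℕ
∑₂ {n} f = ∑[ u < n ] ∑[ v < n ] f u v

module _ {n : ℕ} where

  ∑₂-mono-≤ : {f g : Fin n → Fin n → ℕ} → (∀ u v → f u v ≤ g u v) → ∑₂ f ≤ ∑₂ g
  ∑₂-mono-≤ f≤g = ∑-mono-≤ (λ u → ∑-mono-≤ (f≤g u))

  ∑₂-distrib-+ : (f g : Fin n → Fin n → ℕ) → ∑₂ (λ u v → f u v + g u v) ≡ ∑₂ f + ∑₂ g
  ∑₂-distrib-+ f g =
    trans (sum-cong-≗ {n} (λ u → ∑-distrib-+ (f u) (g u)))
          (∑-distrib-+ (λ u → ∑[ v < n ] f u v) (λ u → ∑[ v < n ] g u v))

  ∑₂-transpose : (f : Fin n → Fin n → ℕ) → ∑₂ (λ u v → f v u) ≡ ∑₂ f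
  ∑₂-transpose f = sym (∑-comm f)

  ∑₂-scale : (c : ℕ) (f : Fin n → Fin n → ℕ) → ∑₂ (λ u v → c * f u v) ≡ c * ∑₂ f
  ∑₂-scale c f =
    sym (trans (*-distribˡ-sum c (λ u → ∑[ v < n ] f u v)) (sum-cong-≗ {n} (λ u → *-distribˡ-sum c (f u))))

  ∑₂-product : (f g : Fin n → ℕ) → ∑₂ (λ u v → f u * g v) ≡ (∑[ u < n ] f u) * (∑[ v < n ] g v)
  ∑₂-product f g = sym (trans (*-distribʳ-sum (∑[ v < n ] g v) f) (sum-cong-≗ {n} (λ u → *-distribˡ-sum (f u) g)))

-- The ring solver does not handle _^_, so cubes appear unfolded as x * (x * (x * 1)).

private
  4ab≤[a+b]²-ordered : ∀ {a b} → a ≤ b → 4 * (a * b) ≤ (a + b) * (a + b)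
  4ab≤[a+b]²-ordered {a} a≤b with d , refl ← m≤n⇒∃[o]m+o≡n a≤b = begin
    4 * (a * (a + d))                 ≤⟨ m≤m+n _ (d * d) ⟩
    4 * (a * (a + d)) + d * d         ≡⟨ square a d ⟩
    (a + (a + d)) * (a + (a + d))     ∎
    where
      open ≤-Reasoning
      square : ∀ a d → 4 * (a * (a + d)) + d * d ≡ (a + (a + d)) * (a + (a + d))
      square = solve-∀

4ab≤[a+b]² : ∀ a b → 4 * (a * b) ≤ (a + b) * (a + b)
4ab≤[a+b]² a b with ≤-total a b
... | inj₁ a≤b = 4ab≤[a+b]²-ordered a≤b
... | inj₂ b≤a = subst₂ (λ x y → 4 * x ≤ y * y) (*-comm b a) (+-comm b a) (4ab≤[a+b]²-ordered b≤a)

-- AM-GM for p, q/2, q/2; equality at q = 2p.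
27pq²≤4[p+q]³ : ∀ p q → 27 * p * (q * q) ≤ 4 * (p + q) ^ 3
27pq²≤4[p+q]³ p q with ≤-total (p + p) q
... | inj₁ 2p≤q with d , refl ← m≤n⇒∃[o]m+o≡n 2p≤q = begin
    27 * p * ((p + p + d) * (p + p + d))                          ≤⟨ m≤m+n _ _ ⟩
    27 * p * ((p + p + d) * (p + p + d)) + d * d * (9 * p + 4 * d) ≡⟨ expand p d ⟩
    4 * (p + (p + p + d)) ^ 3                                      ∎
  where
    open ≤-Reasoning
    expand : ∀ p d → 27 * p * ((p + p + d) * (p + p + d)) + d * d * (9 * p + 4 * d)
                   ≡ 4 * ((p + (p + p + d)) * ((p + (p + p + d)) * ((p + (p + p + d)) * 1)))
    expand = solve-∀
... | inj₂ q≤2p with d , 2p≡q+d ← m≤n⇒∃[o]m+o≡n q≤2p = *-cancelˡ-≤ 8 (begin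
    8 * (27 * p * (q * q))                         ≡⟨ double p q ⟩
    108 * ((p + p) * (q * q))                      ≡⟨ cong (λ x → 108 * (x * (q * q))) (sym 2p≡q+d) ⟩
    108 * ((q + d) * (q * q))                      ≤⟨ m≤m+n _ _ ⟩
    108 * ((q + d) * (q * q)) + 4 * (d * d) * (9 * q + d) ≡⟨ expand q d ⟩
    4 * ((q + d) + (q + q)) ^ 3                    ≡⟨ cong (λ x → 4 * (x + (q + q)) ^ 3) 2p≡q+d ⟩
    4 * ((p + p) + (q + q)) ^ 3                    ≡⟨ scale p q ⟩
    8 * (4 * (p + q) ^ 3)                          ∎)
  where
    open ≤-Reasoning
    double : ∀ p q → 8 * (27 * p * (q * q)) ≡ 108 * ((p + p) * (q * q))
    double = solve-∀
    expand : ∀ q d → 108 * ((q + d) * (q * q)) + 4 * (d * d) * (9 * q + d)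
                   ≡ 4 * ((q + d + (q + q)) * ((q + d + (q + q)) * ((q + d + (q + q)) * 1)))
    expand = solve-∀
    scale : ∀ p q → 4 * ((p + p + (q + q)) * ((p + p + (q + q)) * ((p + p + (q + q)) * 1)))
                  ≡ 8 * (4 * ((p + q) * ((p + q) * ((p + q) * 1))))
    scale = solve-∀

27p[p+ab]≤27n²+n³ : ∀ {p a b n} → p + a + b ≡ n → 27 * (p * (p + a * b)) ≤ 27 * (n * n) + n ^ 3
27p[p+ab]≤27n²+n³ {p} {a} {b} {n} refl = *-cancelˡ-≤ 4 (begin
    4 * (27 * (p * (p + a * b)))                      ≡⟨ split p a b ⟩
    108 * (p * p) + 27 * p * (4 * (a * b))            ≤⟨ +-mono-≤ (*-monoʳ-≤ 108 (*-mono-≤ p≤n p≤n))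
                                                                  (*-monoʳ-≤ (27 * p) (4ab≤[a+b]² a b)) ⟩
    108 * (n * n) + 27 * p * ((a + b) * (a + b))      ≤⟨ +-monoʳ-≤ (108 * (n * n)) (27pq²≤4[p+q]³ p (a + b)) ⟩
    108 * (n * n) + 4 * (p + (a + b)) ^ 3             ≡⟨ combine p a b ⟩
    4 * (27 * (n * n) + n ^ 3)                        ∎)
  where
    open ≤-Reasoning
    p≤n : p ≤ n
    p≤n = ≤-trans (m≤m+n p a) (m≤m+n (p + a) b)
    split : ∀ p a b → 4 * (27 * (p * (p + a * b))) ≡ 108 * (p * p) + 27 * p * (4 * (a * b))
    split = solve-∀
    combine : ∀ p a b → 108 * ((p + a + b) * (p + a + b)) + 4 * ((p + (a + b)) * ((p + (a + b)) * ((p + (a + b)) * 1)))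
                      ≡ 4 * (27 * ((p + a + b) * (p + a + b)) + (p + a + b) * ((p + a + b) * ((p + a + b) * 1)))
    combine = solve-∀

27[k+1]M≤[k+2]n³ : ∀ k n M → 27 * suc k ≤ n → 27 * M ≤ 27 * (n * n) + n ^ 3 → 27 * suc k * M ≤ (2 + k) * n ^ 3
27[k+1]M≤[k+2]n³ k n M n-large 27M≤ = begin
    27 * suc k * M                           ≡⟨ reassoc k M ⟩
    suc k * (27 * M)                         ≤⟨ *-monoʳ-≤ (suc k) 27M≤ ⟩
    suc k * (27 * (n * n) + n ^ 3)           ≡⟨ distrib k n ⟩
    27 * suc k * (n * n) + suc k * n ^ 3     ≤⟨ +-monoˡ-≤ (suc k * n ^ 3) (*-monoˡ-≤ (n * n) n-large) ⟩
    n * (n * n) + suc k * n ^ 3              ≡⟨ collect k n ⟩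
    (2 + k) * n ^ 3                          ∎
  where
    open ≤-Reasoning
    reassoc : ∀ k M → 27 * suc k * M ≡ suc k * (27 * M)
    reassoc = solve-∀
    distrib : ∀ k n → suc k * (27 * (n * n) + n * (n * (n * 1))) ≡ 27 * suc k * (n * n) + suc k * (n * (n * (n * 1)))
    distrib = solve-∀
    collect : ∀ k n → n * (n * n) + suc k * (n * (n * (n * 1))) ≡ (2 + k) * (n * (n * (n * 1)))
    collect = solve-∀

9[k+1]≤t : ∀ k t → 27 * suc k ≤ 2 + 3 * t → 9 * suc k ≤ t
9[k+1]≤t k t 27[k+1]≤ = ≤-pred (*-cancelˡ-< 3 (9 * suc k) (suc t) (begin-strict
    3 * (9 * suc k)   ≡⟨ sym (*-assoc 3 9 (suc k)) ⟩
    27 * suc k        ≤⟨ 27[k+1]≤ ⟩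
    2 + 3 * t         <⟨ +-monoˡ-< (3 * t) (n<1+n 2) ⟩
    3 + 3 * t         ≡⟨ sym (*-suc 3 t) ⟩
    3 * suc t         ∎))
  where open ≤-Reasoning

3⌊n/3⌋≤n : ∀ n → n / 3 + n / 3 + n / 3 ≤ n
3⌊n/3⌋≤n n = subst (_≤ n) (triple (n / 3)) (m/n*n≤m n 3)
  where
    triple : ∀ t → t * 3 ≡ t + t + t
    triple = solve-∀

n≤2+3⌊n/3⌋ : ∀ n → n ≤ 2 + 3 * (n / 3)
n≤2+3⌊n/3⌋ n = begin
  n                       ≡⟨ m≡m%n+[m/n]*n n 3 ⟩
  n % 3 + n / 3 * 3       ≤⟨ +-monoˡ-≤ (n / 3 * 3) (≤-pred (m%n<n n 3)) ⟩
  2 + n / 3 * 3           ≡⟨ cong (2 +_) (*-comm (n / 3) 3) ⟩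
  2 + 3 * (n / 3)         ∎
  where open ≤-Reasoning

kn³≤27[k+1]t³ : ∀ k n t → 27 * suc k ≤ n → n ≤ 2 + 3 * t → k * n ^ 3 ≤ 27 * suc k * (t * t * t)
kn³≤27[k+1]t³ k n t n-large n≤2+3t = begin
    k * n ^ 3                                                   ≤⟨ *-monoʳ-≤ k (^-monoˡ-≤ 3 n≤2+3t) ⟩
    k * (2 + 3 * t) ^ 3                                         ≡⟨ cong (k *_) (expand t) ⟩
    k * (27 * (t * t * t) + 54 * (t * t) + (36 * t + 8))        ≤⟨ *-monoʳ-≤ k (+-monoʳ-≤ (27 * (t * t * t) + 54 * (t * t)) linear≤) ⟩
    k * (27 * (t * t * t) + 54 * (t * t) + 44 * (t * t))        ≡⟨ regroup k t ⟩
    27 * k * (t * t * t) + 98 * k * (t * t)                     ≤⟨ +-monoʳ-≤ (27 * k * (t * t * t)) (*-monoˡ-≤ (t * t) 98k≤27t) ⟩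
    27 * k * (t * t * t) + 27 * t * (t * t)                     ≡⟨ collect k t ⟩
    27 * suc k * (t * t * t)                                    ∎
  where
    open ≤-Reasoning
    9[k+1]≤t′ : 9 * suc k ≤ t
    9[k+1]≤t′ = 9[k+1]≤t k t (≤-trans n-large n≤2+3t)
    1≤t : 1 ≤ t
    1≤t = ≤-trans (s≤s z≤n) 9[k+1]≤t′
    linear≤ : 36 * t + 8 ≤ 44 * (t * t)
    linear≤ = begin
      36 * t + 8       ≤⟨ +-monoʳ-≤ (36 * t) (*-monoʳ-≤ 8 1≤t) ⟩
      36 * t + 8 * t   ≡⟨ sym (*-distribʳ-+ t 36 8) ⟩
      44 * t           ≡⟨ cong (44 *_) (sym (*-identityʳ t)) ⟩
      44 * (t * 1)     ≤⟨ *-monoʳ-≤ 44 (*-monoʳ-≤ t 1≤t) ⟩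
      44 * (t * t)     ∎
    98k≤27t : 98 * k ≤ 27 * t
    98k≤27t = begin
      98 * k             ≤⟨ *-monoˡ-≤ k (m≤m+n 98 145) ⟩
      243 * k            ≤⟨ m≤m+n (243 * k) 243 ⟩
      243 * k + 243      ≡⟨ factor k ⟩
      27 * (9 * suc k)   ≤⟨ *-monoʳ-≤ 27 9[k+1]≤t′ ⟩
      27 * t             ∎
      where
        factor : ∀ k → 243 * k + 243 ≡ 27 * (9 * suc k)
        factor = solve-∀
    expand : ∀ t → (2 + 3 * t) * ((2 + 3 * t) * ((2 + 3 * t) * 1)) ≡ 27 * (t * t * t) + 54 * (t * t) + (36 * t + 8)
    expand = solve-∀
    regroup : ∀ k t → k * (27 * (t * t * t) + 54 * (t * t) + 44 * (t * t)) ≡ 27 * k * (t * t * t) + 98 * k * (t * t)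
    regroup = solve-∀
    collect : ∀ k t → 27 * k * (t * t * t) + 27 * t * (t * t) ≡ 27 * suc k * (t * t * t)
    collect = solve-∀

module Reachability {n : ℕ} (G : Graph n) where

  reach-refl : ∀ u → T (reach G 0 u u)
  reach-refl u = fromWitness refl

  reach⁰⇒≡ : ∀ u v → T (reach G 0 u v) → u ≡ v
  reach⁰⇒≡ u v = toWitness

  reach-suc : ∀ k u v → T (reach G k u v) → T (reach G (suc k) u v)
  reach-suc k u v r = Equivalence.from T-∨ (inj₁ r)

  reach-step : ∀ k u x v → T (reach G k u x) → T (adj G x v) → T (reach G (suc k) u v)
  reach-step k u x v r a =
    Equivalence.from T-∨ (inj₂ (any⁺ _ (lose (∈-allFin x) (Equivalence.from T-∧ (r , a)))))

  reach-last : ∀ k u v → T (reach G (suc k) u v) →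
    T (reach G k u v) ⊎ ∃ λ x → T (reach G k u x) × T (adj G x v)
  reach-last k u v r with Equivalence.to T-∨ r
  ... | inj₁ r′ = inj₁ r′
  ... | inj₂ r′ with x , rx∧a ← satisfied (any⁻ _ (allFin n) r′) = inj₂ (x , Equivalence.to T-∧ rx∧a)

  reach-mono : ∀ {j k} u v → j ≤ k → T (reach G j u v) → T (reach G k u v)
  reach-mono {k = zero}  u v z≤n r = r
  reach-mono {k = suc k} u v z≤n r = reach-suc k u v (reach-mono {k = k} u v z≤n r)
  reach-mono {suc j} {suc k} u v (s≤s j≤k) r with reach-last j u v r
  ... | inj₁ r′            = reach-suc k u v (reach-mono u v j≤k r′)
  ... | inj₂ (x , rx , a) = reach-step k u x v (reach-mono u x j≤k rx) a

  reach-edge : ∀ k u v → T (adj G u v) → T (reach G (suc k) u v)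
  reach-edge k u v a = reach-mono {k = suc k} u v (s≤s z≤n) (reach-step 0 u u v (reach-refl u) a)

  reach-path₂ : ∀ u x v → T (adj G u x) → T (adj G x v) → T (reach G 2 u v)
  reach-path₂ u x v a b = reach-step 1 u x v (reach-edge 0 u x a) b

  reach-trans : ∀ a b u x v → T (reach G a u x) → T (reach G b x v) → T (reach G (b + a) u v)
  reach-trans a zero    u x v rux rxv = subst (T ∘ reach G a u) (reach⁰⇒≡ x v rxv) rux
  reach-trans a (suc b) u x v rux rxv with reach-last b x v rxv
  ... | inj₁ rxv′          = reach-suc (b + a) u v (reach-trans a b u x v rux rxv′)
  ... | inj₂ (y , rxy , e) = reach-step (b + a) u y v (reach-trans a b u x y rux rxy) e

  lipschitz-≤-reach : (f : Fin n → ℕ) → (∀ x y → T (adj G x y) → f y ≤ suc (f x)) →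
    ∀ k w y → f w ≡ 0 → T (reach G k w y) → f y ≤ k
  lipschitz-≤-reach f lip zero    w y fw≡0 r = ≤-reflexive (trans (cong f (sym (reach⁰⇒≡ w y r))) fw≡0)
  lipschitz-≤-reach f lip (suc k) w y fw≡0 r with reach-last k w y r
  ... | inj₁ r′            = m≤n⇒m≤1+n (lipschitz-≤-reach f lip k w y fw≡0 r′)
  ... | inj₂ (x , rx , a) = ≤-trans (lip x y a) (s≤s (lipschitz-≤-reach f lip k w x fw≡0 rx))

  firstReach-complete : ∀ u w m (f : ℕ → ℕ) i → i < m → T (reach G (f i) u w) →
    ∃ λ j → j ≤ i × firstReach G u w (applyUpTo f m) ≡ just (f j)
  firstReach-complete u w (suc m) f zero _ r with reach G (f 0) u w
  ... | true = 0 , z≤n , refl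
  firstReach-complete u w (suc m) f (suc i) (s≤s i<m) r with reach G (f 0) u w
  ... | true  = 0 , z≤n , refl
  ... | false with j , j≤i , eq ← firstReach-complete u w m (f ∘ suc) i i<m r = suc j , s≤s j≤i , eq

  firstReach-sound : ∀ u w {b} m (f : ℕ → ℕ) → firstReach G u w (applyUpTo f m) ≡ just b → T (reach G b u w)
  firstReach-sound u w (suc m) f eq with reach G (f 0) u w in r
  ... | true with refl ← eq = Equivalence.from T-≡ r
  ... | false = firstReach-sound u w m (f ∘ suc) eq

  dist-complete : ∀ {k} u w → k < n → T (reach G k u w) → ∃ λ j → j ≤ k × dist G u w ≡ just j
  dist-complete u w = firstReach-complete u w n id _

  dist-sound : ∀ u w {b} → dist G u w ≡ just b → T (reach G b u w)
  dist-sound u w = firstReach-sound u w n id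

  reach⇒dist≢nothing : ∀ {k} u v → k < n → T (reach G k u v) → dist G u v ≢ nothing
  reach⇒dist≢nothing u v k<n r with _ , _ , d ← dist-complete u v k<n r = λ d′ → case trans (sym d) d′ of λ ()

  strictlyCloser-intro : ∀ {k} w x y → k < n → T (reach G k w x) → ¬ T (reach G k w y) →
    T (strictlyCloser G w x y)
  strictlyCloser-intro w x y k<n rx ¬ry with dist-complete w x k<n rx
  ... | j , j≤k , dx rewrite dx with dist G w y in dy
  ... | nothing = tt
  ... | just b  = <⇒<ᵇ (≤-<-trans j≤k (≰⇒> {b} λ b≤k → ¬ry (reach-mono w y b≤k (dist-sound w y dy))))

  strictlyCloser-asym : ∀ w u v → T (strictlyCloser G w u v) → ¬ T (strictlyCloser G w v u)
  strictlyCloser-asym w u v with dist G w u | dist G w v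
  ... | just a  | just b  = λ a<b b<a → <-asym (<ᵇ⇒< a b a<b) (<ᵇ⇒< b a b<a)
  ... | just a  | nothing = λ _ ()
  ... | nothing | _       = λ ()

module TerminalIndex {n : ℕ} (G : Graph n) where
  open Reachability G using (strictlyCloser-asym)

  countV-∑ : ∀ p → countV G p ≡ ∑[ u < n ] [ p u ]
  countV-∑ p = sum-map-allFin n (λ u → [ p u ])

  countV-mono : ∀ {p q} → (∀ u → [ p u ] ≤ [ q u ]) → countV G p ≤ countV G q
  countV-mono {p} {q} p≤q = subst₂ _≤_ (sym (countV-∑ p)) (sym (countV-∑ q)) (∑-mono-≤ p≤q)

  pendents : ℕ
  pendents = countV G (isPendent G)

  MoT-∑₂ : MoT G ≡ ∑₂ (edgeTerm G)
  MoT-∑₂ = trans (sum-map-allFin n _) (sum-cong-≗ {n} (λ u → sum-map-allFin n (edgeTerm G u)))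

  edgeTerm-≡ : ∀ u v → T (adj G u v) → toℕ u < toℕ v → edgeTerm G u v ≡ ∣ ℓ G u v - ℓ G v u ∣
  edgeTerm-≡ u v a u<v rewrite Equivalence.to T-≡ a | Equivalence.to T-≡ (<⇒<ᵇ u<v) = refl

  ∣ℓ-ℓ∣≤pendents : ∀ u v → ∣ ℓ G u v - ℓ G v u ∣ ≤ pendents
  ∣ℓ-ℓ∣≤pendents u v = ≤-trans (∣m-n∣≤m⊔n (ℓ G u v) (ℓ G v u)) (⊔-lub (ℓ≤pendents u v) (ℓ≤pendents v u))
    where
      ℓ≤pendents : ∀ u v → ℓ G u v ≤ pendents
      ℓ≤pendents u v = countV-mono (λ w → [∧]≤[] (isPendent G w) (strictlyCloser G w u v))

  ∣ℓ-ℓ∣≡pendents : ∀ x y → (∀ w → T (isPendent G w) → T (strictlyCloser G w x y)) →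
    ∣ ℓ G x y - ℓ G y x ∣ ≡ pendents
  ∣ℓ-ℓ∣≡pendents x y closer = begin
    ∣ ℓ G x y - ℓ G y x ∣   ≡⟨ cong₂ ∣_-_∣ ℓxy≡pendents ℓyx≡0 ⟩
    ∣ pendents - 0 ∣        ≡⟨ ∣-∣-identityʳ pendents ⟩
    pendents                ∎
    where
      open ≡-Reasoning
      ℓxy≡pendents : ℓ G x y ≡ pendents
      ℓxy≡pendents = begin
        ℓ G x y                                              ≡⟨ countV-∑ _ ⟩
        ∑[ w < n ] [ isPendent G w ∧ strictlyCloser G w x y ] ≡⟨ sum-cong-≗ {n} (λ w → [∧]≡[] _ _ (closer w)) ⟩
        ∑[ w < n ] [ isPendent G w ]                          ≡⟨ countV-∑ _ ⟨
        pendents                                              ∎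
      ℓyx≡0 : ℓ G y x ≡ 0
      ℓyx≡0 = begin
        ℓ G y x                                              ≡⟨ countV-∑ _ ⟩
        ∑[ w < n ] [ isPendent G w ∧ strictlyCloser G w y x ]
          ≡⟨ sum-cong-≗ {n} (λ w → [∧]≡0 _ _ (strictlyCloser-asym w x y ∘ closer w)) ⟩
        ∑[ w < n ] 0                                          ≡⟨ sum-replicate-zero n ⟩
        0                                                     ∎

-- The upper bound

module UpperBound {n : ℕ} (G : Graph n) where
  open TerminalIndex G

  degreeSum : ℕ
  degreeSum = ∑₂ (λ u v → [ adj G u v ])

  edgeTerm-pair≤ : ∀ u v → edgeTerm G u v + edgeTerm G v u ≤ pendents * [ adj G u v ]
  edgeTerm-pair≤ u v rewrite symm G v u with adj G u v
  ... | false = z≤n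
  ... | true with toℕ u <ᵇ toℕ v in u<v | toℕ v <ᵇ toℕ u in v<u
  ... | false | false = z≤n
  ... | true  | false = subst₂ _≤_ (sym (+-identityʳ _)) (sym (*-identityʳ pendents)) (∣ℓ-ℓ∣≤pendents u v)
  ... | false | true  = subst (∣ ℓ G v u - ℓ G u v ∣ ≤_) (sym (*-identityʳ pendents)) (∣ℓ-ℓ∣≤pendents v u)
  ... | true  | true  = ⊥-elim (<-asym (<ᵇ⇒< (toℕ u) (toℕ v) (Equivalence.from T-≡ u<v))
                                       (<ᵇ⇒< (toℕ v) (toℕ u) (Equivalence.from T-≡ v<u)))

  MoT+MoT≤ : MoT G + MoT G ≤ pendents * degreeSum
  MoT+MoT≤ = begin
    MoT G + MoT G                                        ≡⟨ cong₂ _+_ MoT-∑₂ (trans MoT-∑₂ (sym (∑₂-transpose (edgeTerm G)))) ⟩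
    ∑₂ (edgeTerm G) + ∑₂ (λ u v → edgeTerm G v u)        ≡⟨ ∑₂-distrib-+ (edgeTerm G) (λ u v → edgeTerm G v u) ⟨
    ∑₂ (λ u v → edgeTerm G u v + edgeTerm G v u)         ≤⟨ ∑₂-mono-≤ edgeTerm-pair≤ ⟩
    ∑₂ (λ u v → pendents * [ adj G u v ])                ≡⟨ ∑₂-scale pendents (λ u v → [ adj G u v ]) ⟩
    pendents * degreeSum                                 ∎
    where open ≤-Reasoning

  pendentEdges≤pendents : ∑₂ (λ u v → [ isPendent G u ∧ adj G u v ]) ≤ pendents
  pendentEdges≤pendents = ≤-trans (∑-mono-≤ row≤) (≤-reflexive (sym (countV-∑ (isPendent G))))
    where
      row≤ : ∀ u → ∑[ v < n ] [ isPendent G u ∧ adj G u v ] ≤ [ isPendent G u ]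
      row≤ u with isPendent G u in pu
      ... | false = ≤-reflexive (sum-replicate-zero n)
      ... | true  = ≤-reflexive (trans (sym (countV-∑ (adj G u))) (≡ᵇ⇒≡ (degree G u) 1 (Equivalence.from T-≡ pu)))

  module Coloured (c : Fin n → Bool) where
    black white : Fin n → ℕ
    black u = [ not (isPendent G u) ∧ c u ]
    white u = [ not (isPendent G u) ∧ not (c u) ]

    #black #white : ℕ
    #black = ∑[ u < n ] black u
    #white = ∑[ u < n ] white u

    pendents+#black+#white≡n : pendents + #black + #white ≡ n
    pendents+#black+#white≡n = begin
      pendents + #black + #white                        ≡⟨ cong (λ x → x + #black + #white) (countV-∑ (isPendent G)) ⟩
      ∑[ u < n ] [ isPendent G u ] + #black + #white    ≡⟨ cong (_+ #white) (∑-distrib-+ _ black) ⟨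
      ∑[ u < n ] ([ isPendent G u ] + black u) + #white ≡⟨ ∑-distrib-+ _ white ⟨
      ∑[ u < n ] ([ isPendent G u ] + black u + white u) ≡⟨ sum-cong-≗ {n} (λ u → partition (isPendent G u) (c u)) ⟩
      ∑[ u < n ] 1                                      ≡⟨ ∑-one n ⟩
      n                                                 ∎
      where
        open ≡-Reasoning
        partition : ∀ p x → [ p ] + [ not p ∧ x ] + [ not p ∧ not x ] ≡ 1
        partition true  x     = refl
        partition false true  = refl
        partition false false = refl

    -- Every edge has a pendent end or joins a black to a white non-pendent vertex.
    degreeSum≤ : (∀ u v → adj G u v ≡ true → c u ≢ c v) →
      degreeSum ≤ pendents + pendents + (#black * #white + #white * #black)
    degreeSum≤ proper = begin
      degreeSum
        ≤⟨ ∑₂-mono-≤ (λ u v → edge-cover (adj G u v) (isPendent G u) (isPendent G v) (c u) (c v) (proper u v)) ⟩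
      ∑₂ (λ u v → leftEnd u v + rightEnd u v + cross u v) ≡⟨ ∑₂-distrib-+ _ cross ⟩
      ∑₂ (λ u v → leftEnd u v + rightEnd u v) + ∑₂ cross  ≡⟨ cong (_+ ∑₂ cross) (∑₂-distrib-+ leftEnd rightEnd) ⟩
      ∑₂ leftEnd + ∑₂ rightEnd + ∑₂ cross             ≤⟨ +-mono-≤ (+-mono-≤ pendentEdges≤pendents rightEnds≤) (≤-reflexive cross≡) ⟩
      pendents + pendents + (#black * #white + #white * #black) ∎
      where
        open ≤-Reasoning
        leftEnd rightEnd cross : Fin n → Fin n → ℕ
        leftEnd  u v = [ isPendent G u ∧ adj G u v ]
        rightEnd u v = [ isPendent G v ∧ adj G u v ]
        cross    u v = black u * white v + white u * black v

        edge-cover : ∀ a pu pv cu cv → (a ≡ true → cu ≢ cv) →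
          [ a ] ≤ [ pu ∧ a ] + [ pv ∧ a ] + ([ not pu ∧ cu ] * [ not pv ∧ not cv ] + [ not pu ∧ not cu ] * [ not pv ∧ cv ])
        edge-cover false pu    pv    cu    cv    _ = z≤n
        edge-cover true  true  pv    cu    cv    _ = s≤s z≤n
        edge-cover true  false true  cu    cv    _ = s≤s z≤n
        edge-cover true  false false true  false _ = s≤s z≤n
        edge-cover true  false false false true  _ = s≤s z≤n
        edge-cover true  false false true  true  h = ⊥-elim (h refl refl)
        edge-cover true  false false false false h = ⊥-elim (h refl refl)

        rightEnds≤ : ∑₂ rightEnd ≤ pendents
        rightEnds≤ = begin
          ∑₂ rightEnd
            ≡⟨ sum-cong-≗ {n} (λ u → sum-cong-≗ {n} (λ v → cong (λ b → [ isPendent G v ∧ b ]) (symm G u v))) ⟩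
          ∑₂ (λ u v → leftEnd v u)      ≡⟨ ∑₂-transpose leftEnd ⟩
          ∑₂ leftEnd                    ≤⟨ pendentEdges≤pendents ⟩
          pendents                      ∎

        cross≡ : ∑₂ cross ≡ #black * #white + #white * #black
        cross≡ = trans (∑₂-distrib-+ (λ u v → black u * white v) (λ u v → white u * black v))
                       (cong₂ _+_ (∑₂-product black white) (∑₂-product white black))

  27MoT≤27n²+n³ : Bipartite G → 27 * MoT G ≤ 27 * (n * n) + n ^ 3
  27MoT≤27n²+n³ (c , proper) =
    ≤-trans (*-monoʳ-≤ 27 MoT≤) (27p[p+ab]≤27n²+n³ {pendents} {#black} {#white} pendents+#black+#white≡n)
    where
      open Coloured c
      open ≤-Reasoning
      MoT≤ : MoT G ≤ pendents * (pendents + #black * #white)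
      MoT≤ = *-cancelˡ-≤ 2 (begin
        2 * MoT G                                                  ≡⟨ cong (MoT G +_) (+-identityʳ (MoT G)) ⟩
        MoT G + MoT G                                              ≤⟨ MoT+MoT≤ ⟩
        pendents * degreeSum                                       ≤⟨ *-monoʳ-≤ pendents (degreeSum≤ proper) ⟩
        pendents * (pendents + pendents + (#black * #white + #white * #black)) ≡⟨ double pendents #black #white ⟩
        2 * (pendents * (pendents + #black * #white))             ∎)
        where
          double : ∀ p a b → p * (p + p + (a * b + b * a)) ≡ 2 * (p * (p + a * b))
          double = solve-∀

-- The extremal graph

data Block : Set where
  sideA sideB leaf : Block

-- K_{t,t} on sideA ∪ sideB, plus leaves hanging from one vertex of sideA;
-- the flags record whether the respective endpoint is that hub vertex.
blockAdj : Block → Block → Bool → Bool → Bool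
blockAdj sideA sideB _   _   = true
blockAdj sideB sideA _   _   = true
blockAdj sideA leaf  hub _   = hub
blockAdj leaf  sideA _   hub = hub
blockAdj _     _     _   _   = false

blockAdj-sym : ∀ x y h₁ h₂ → blockAdj x y h₁ h₂ ≡ blockAdj y x h₂ h₁
blockAdj-sym sideA sideA _ _ = refl
blockAdj-sym sideA sideB _ _ = refl
blockAdj-sym sideA leaf  _ _ = refl
blockAdj-sym sideB sideA _ _ = refl
blockAdj-sym sideB sideB _ _ = refl
blockAdj-sym sideB leaf  _ _ = refl
blockAdj-sym leaf  sideA _ _ = refl
blockAdj-sym leaf  sideB _ _ = refl
blockAdj-sym leaf  leaf  _ _ = refl

blockAdj-irrefl : ∀ x h → blockAdj x x h h ≡ false
blockAdj-irrefl sideA _ = refl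
blockAdj-irrefl sideB _ = refl
blockAdj-irrefl leaf  _ = refl

isSideA isSideB isLeaf : Block → Bool
isSideA sideA = true
isSideA _     = false
isSideB sideB = true
isSideB _     = false
isLeaf  leaf  = true
isLeaf  _     = false

blockAdj-proper : ∀ x y h₁ h₂ → blockAdj x y h₁ h₂ ≡ true → isSideA x ≢ isSideA y
blockAdj-proper sideA sideB _ _ _ ()
blockAdj-proper sideB sideA _ _ _ ()
blockAdj-proper sideA leaf  _ _ _ ()
blockAdj-proper leaf  sideA _ _ _ ()
blockAdj-proper sideA sideA _ _ ()
blockAdj-proper sideB sideB _ _ ()
blockAdj-proper sideB leaf  _ _ ()
blockAdj-proper leaf  sideB _ _ ()
blockAdj-proper leaf  leaf  _ _ ()

sideA-adj⇒¬sideA : ∀ y h₁ h₂ → T (blockAdj sideA y h₁ h₂) → y ≢ sideA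
sideA-adj⇒¬sideA sideA _ _ () _
sideA-adj⇒¬sideA sideB _ _ _ ()
sideA-adj⇒¬sideA leaf  _ _ _ ()

depth : Block → ℕ
depth sideA = 3
depth _     = 2

2≤depth : ∀ b → 2 ≤ depth b
2≤depth sideA = s≤s (s≤s z≤n)
2≤depth sideB = ≤-refl
2≤depth leaf  = ≤-refl

depth≤3 : ∀ b → depth b ≤ 3
depth≤3 sideA = ≤-refl
depth≤3 sideB = s≤s (s≤s z≤n)
depth≤3 leaf  = s≤s (s≤s z≤n)

depth-¬A : ∀ b → b ≢ sideA → depth b ≡ 2
depth-¬A sideA b≢A = ⊥-elim (b≢A refl)
depth-¬A sideB _   = refl
depth-¬A leaf  _   = refl

blockAdj-leaf-nonhub : ∀ y h → blockAdj leaf y h false ≡ false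
blockAdj-leaf-nonhub sideA _ = refl
blockAdj-leaf-nonhub sideB _ = refl
blockAdj-leaf-nonhub leaf  _ = refl

leaf-adj⇒hub : ∀ y h₁ h₂ → T (blockAdj leaf y h₁ h₂) → T h₂
leaf-adj⇒hub sideA _ _ r = r
leaf-adj⇒hub sideB _ _ ()
leaf-adj⇒hub leaf  _ _ ()

isLeaf⇒≡leaf : ∀ {b} → T (isLeaf b) → b ≡ leaf
isLeaf⇒≡leaf {leaf} _ = refl

≥2⇒≡ᵇ1≡false : ∀ {d} → 2 ≤ d → (d ≡ᵇ 1) ≡ false
≥2⇒≡ᵇ1≡false (s≤s (s≤s _)) = refl

module Construction (t m : ℕ) (2≤t : 2 ≤ t) (3t≤n : t + t + t ≤ suc m) where

  block : ℕ → Block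
  block a = if a <ᵇ t then sideA else if a <ᵇ t + t then sideB else leaf

  block-A : ∀ {a} → a < t → block a ≡ sideA
  block-A a<t rewrite Equivalence.to T-≡ (<⇒<ᵇ a<t) = refl

  block-B : ∀ {a} → t ≤ a → a < t + t → block a ≡ sideB
  block-B {a} t≤a a<2t
    rewrite ¬T⇒≡false (λ a<t → <⇒≱ (<ᵇ⇒< a t a<t) t≤a) | Equivalence.to T-≡ (<⇒<ᵇ a<2t) = refl

  block-leaf : ∀ {a} → t + t ≤ a → block a ≡ leaf
  block-leaf {a} 2t≤a
    rewrite ¬T⇒≡false (λ a<t → <⇒≱ (<ᵇ⇒< a t a<t) (≤-trans (m≤m+n t t) 2t≤a))
          | ¬T⇒≡false (λ a<2t → <⇒≱ (<ᵇ⇒< a (t + t) a<2t) 2t≤a) = refl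

  data BlockView (a : ℕ) : Block → Set where
    inSideA : a < t → BlockView a sideA
    inSideB : t ≤ a → a < t + t → BlockView a sideB
    inLeaves : t + t ≤ a → BlockView a leaf

  blockView : ∀ a → BlockView a (block a)
  blockView a with a <? t
  ... | yes a<t = subst (BlockView a) (sym (block-A a<t)) (inSideA a<t)
  ... | no a≮t with a <? t + t
  ...   | yes a<2t = subst (BlockView a) (sym (block-B (≮⇒≥ a≮t) a<2t)) (inSideB (≮⇒≥ a≮t) a<2t)
  ...   | no a≮2t  = subst (BlockView a) (sym (block-leaf (≮⇒≥ a≮2t))) (inLeaves (≮⇒≥ a≮2t))

  viewOf : ∀ {a b} → block a ≡ b → BlockView a b
  viewOf {a} e = subst (BlockView a) e (blockView a)

  0<t : 0 < t
  0<t = ≤-trans (s≤s z≤n) 2≤t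

  block-hub : block 0 ≡ sideA
  block-hub = block-A 0<t

  adjℕ : ℕ → ℕ → Bool
  adjℕ a b = blockAdj (block a) (block b) (a ≡ᵇ 0) (b ≡ᵇ 0)

  G : Graph (suc m)
  G = record
    { adj    = λ x y → adjℕ (toℕ x) (toℕ y)
    ; symm   = λ x y → blockAdj-sym (block (toℕ x)) (block (toℕ y)) _ _
    ; irrefl = λ x → blockAdj-irrefl (block (toℕ x)) _
    }

  open Reachability G
  open TerminalIndex G

  bipartite : Bipartite G
  bipartite = isSideA ∘ block ∘ toℕ , λ x y → blockAdj-proper (block (toℕ x)) (block (toℕ y)) _ _

  t<n : t < suc m
  t<n = ≤-trans (m<m+n t 0<t) (≤-trans (m≤m+n (t + t) t) 3t≤n)

  2t≤n : t + t ≤ suc m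
  2t≤n = ≤-trans (m≤m+n (t + t) t) 3t≤n

  4<n : 4 < suc m
  4<n = ≤-trans (s≤s (s≤s (s≤s (s≤s (s≤s z≤n))))) (≤-trans (+-mono-≤ (+-mono-≤ 2≤t 2≤t) 2≤t) 3t≤n)

  hub : Fin (suc m)
  hub = fzero

  b₀ : Fin (suc m)
  b₀ = fromℕ< t<n

  block-b₀ : block (toℕ b₀) ≡ sideB
  block-b₀ = trans (cong block (toℕ-fromℕ< t<n)) (block-B ≤-refl (m<m+n t 0<t))

  flip : ∀ x y → T (adj G x y) → T (adj G y x)
  flip x y = subst T (symm G x y)

  hub-adj : ∀ x {b} → block (toℕ x) ≡ b → b ≢ sideA → T (adj G hub x)
  hub-adj x refl ¬A rewrite block-hub with block (toℕ x)
  ... | sideA = ⊥-elim (¬A refl)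
  ... | sideB = tt
  ... | leaf  = tt

  b₀-adj : ∀ x → block (toℕ x) ≡ sideA → T (adj G b₀ x)
  b₀-adj x eA rewrite block-b₀ | eA = tt

  hub-reaches : ∀ x → T (reach G 2 hub x)
  hub-reaches x = byBlock (block (toℕ x)) refl
    where
      byBlock : ∀ b → block (toℕ x) ≡ b → T (reach G 2 hub x)
      byBlock sideA e = reach-path₂ hub b₀ x (hub-adj b₀ block-b₀ λ ()) (b₀-adj x e)
      byBlock sideB e = reach-edge 1 hub x (hub-adj x e λ ())
      byBlock leaf  e = reach-edge 1 hub x (hub-adj x e λ ())

  reaches-hub : ∀ x → T (reach G 2 x hub)
  reaches-hub x = byBlock (block (toℕ x)) refl
    where
      byBlock : ∀ b → block (toℕ x) ≡ b → T (reach G 2 x hub)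
      byBlock sideA e = reach-path₂ x b₀ hub (flip b₀ x (b₀-adj x e)) (b₀-adj hub block-hub)
      byBlock sideB e = reach-edge 1 x hub (flip hub x (hub-adj x e λ ()))
      byBlock leaf  e = reach-edge 1 x hub (flip hub x (hub-adj x e λ ()))

  connected : Connected G
  connected u v = reach⇒dist≢nothing u v 4<n (reach-trans 2 2 u hub v (reaches-hub u) (hub-reaches v))

  degree-∑ : ∀ w → degree G w ≡ ∑[ i < suc m ] [ adjℕ (toℕ w) (toℕ i) ]
  degree-∑ w = countV-∑ (adj G w)

  degree-leaf : ∀ a → block a ≡ leaf → ∑[ i < suc m ] [ adjℕ a (toℕ i) ] ≡ 1
  degree-leaf a e rewrite e | block-hub =
    cong suc (trans (sum-cong-≗ {m} (λ i → cong [_] (blockAdj-leaf-nonhub (block (suc (toℕ i))) _))) (sum-replicate-zero m))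

  degree-A : ∀ a → block a ≡ sideA → t ≤ ∑[ i < suc m ] [ adjℕ a (toℕ i) ]
  degree-A a e = ∑-interval (suc m) t t (λ i → [ adjℕ a i ]) 2t≤n edge
    where
      edge : ∀ i → t ≤ i → i < t + t → 1 ≤ [ adjℕ a i ]
      edge i t≤i i<2t rewrite e | block-B t≤i i<2t = ≤-refl

  degree-B : ∀ a → block a ≡ sideB → t ≤ ∑[ i < suc m ] [ adjℕ a (toℕ i) ]
  degree-B a e = ∑-interval (suc m) 0 t (λ i → [ adjℕ a i ]) (≤-trans (m≤m+n t t) 2t≤n) edge
    where
      edge : ∀ i → 0 ≤ i → i < t → 1 ≤ [ adjℕ a i ]
      edge i _ i<t rewrite e | block-A i<t = ≤-refl

  isPendent≡isLeaf : ∀ w → isPendent G w ≡ isLeaf (block (toℕ w))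
  isPendent≡isLeaf w = byBlock (block (toℕ w)) refl
    where
      byBlock : ∀ b → block (toℕ w) ≡ b → isPendent G w ≡ isLeaf b
      byBlock sideA e = ≥2⇒≡ᵇ1≡false (≤-trans 2≤t (subst (t ≤_) (sym (degree-∑ w)) (degree-A (toℕ w) e)))
      byBlock sideB e = ≥2⇒≡ᵇ1≡false (≤-trans 2≤t (subst (t ≤_) (sym (degree-∑ w)) (degree-B (toℕ w) e)))
      byBlock leaf  e = cong (_≡ᵇ 1) (trans (degree-∑ w) (degree-leaf (toℕ w) e))

  pendent⇒leaf : ∀ w → T (isPendent G w) → block (toℕ w) ≡ leaf
  pendent⇒leaf w p = isLeaf⇒≡leaf (subst T (isPendent≡isLeaf w) p)

  module FromLeaf (w : Fin (suc m)) (w-leaf : block (toℕ w) ≡ leaf) where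

    -- the distance from w; being 1-Lipschitz along edges, it bounds walk lengths from w below
    potential : Fin (suc m) → ℕ
    potential x = if toℕ x ≡ᵇ toℕ w then 0 else if toℕ x ≡ᵇ 0 then 1 else depth (block (toℕ x))

    ≢w : ∀ (x : Fin (suc m)) {b} → block (toℕ x) ≡ b → b ≢ leaf → (toℕ x ≡ᵇ toℕ w) ≡ false
    ≢w x e b≢leaf = ¬T⇒≡false λ x≡w →
      b≢leaf (trans (sym e) (trans (cong block (≡ᵇ⇒≡ (toℕ x) (toℕ w) x≡w)) w-leaf))

    ≢hub : ∀ (x : Fin (suc m)) {b} → block (toℕ x) ≡ b → b ≢ sideA → (toℕ x ≡ᵇ 0) ≡ false
    ≢hub x e b≢A = ¬T⇒≡false λ x≡0 → b≢A (trans (sym e) (trans (cong block (≡ᵇ⇒≡ (toℕ x) 0 x≡0)) block-hub))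

    potential-w : potential w ≡ 0
    potential-w with toℕ w ≡ᵇ toℕ w | ≡⇒≡ᵇ (toℕ w) (toℕ w) refl
    ... | true | _ = refl

    potential-depth : ∀ x → (toℕ x ≡ᵇ toℕ w) ≡ false → (toℕ x ≡ᵇ 0) ≡ false →
      potential x ≡ depth (block (toℕ x))
    potential-depth x x≢w x≢0 = cong₂ (λ a b → if a then 0 else if b then 1 else depth (block (toℕ x))) x≢w x≢0

    potential-hub : potential hub ≡ 1
    potential-hub = cong (if_then 0 else 1) (≢w hub block-hub λ ())

    potential-B : ∀ v → block (toℕ v) ≡ sideB → potential v ≡ 2
    potential-B v e = trans (potential-depth v (≢w v e λ ()) (≢hub v e λ ())) (cong depth e)

    potential-A : ∀ u → block (toℕ u) ≡ sideA → toℕ u ≢ 0 → potential u ≡ 3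
    potential-A u e u≢0 =
      trans (potential-depth u (≢w u e λ ()) (¬T⇒≡false (u≢0 ∘ ≡ᵇ⇒≡ (toℕ u) 0))) (cong depth e)

    potential≤ : ∀ y → potential y ≤ depth (block (toℕ y))
    potential≤ y with toℕ y ≡ᵇ toℕ w
    ... | true = z≤n
    ... | false with toℕ y ≡ᵇ 0
    ...   | true  = ≤-trans (s≤s z≤n) (2≤depth (block (toℕ y)))
    ...   | false = ≤-refl

    lipschitz : ∀ x y → T (adj G x y) → potential y ≤ suc (potential x)
    lipschitz x y a with toℕ x ≡ᵇ toℕ w in x≡w
    ... | true = ≤-reflexive (trans (cong potential y≡hub) potential-hub)
      where
        x-leaf : block (toℕ x) ≡ leaf
        x-leaf = trans (cong block (≡ᵇ⇒≡ (toℕ x) (toℕ w) (Equivalence.from T-≡ x≡w))) w-leaf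
        y≡hub : y ≡ hub
        y≡hub = toℕ-injective (≡ᵇ⇒≡ (toℕ y) 0
                  (leaf-adj⇒hub (block (toℕ y)) _ _ (subst (λ b → T (blockAdj b (block (toℕ y)) _ _)) x-leaf a)))
    ... | false with toℕ x ≡ᵇ 0 in x≡0
    ...   | true  = ≤-trans (potential≤ y) (≤-reflexive (depth-¬A (block (toℕ y)) y≢A))
      where
        x-hub : block (toℕ x) ≡ sideA
        x-hub = trans (cong block (≡ᵇ⇒≡ (toℕ x) 0 (Equivalence.from T-≡ x≡0))) block-hub
        y≢A : block (toℕ y) ≢ sideA
        y≢A = sideA-adj⇒¬sideA (block (toℕ y)) _ _ (subst (λ b → T (blockAdj b (block (toℕ y)) _ _)) x-hub a)
    ...   | false = ≤-trans (potential≤ y) (≤-trans (depth≤3 (block (toℕ y))) (s≤s (2≤depth (block (toℕ x)))))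

    ¬reach₁-B : ∀ v → block (toℕ v) ≡ sideB → ¬ T (reach G 1 w v)
    ¬reach₁-B v e r = case subst (_≤ 1) (potential-B v e) (lipschitz-≤-reach potential lipschitz 1 w v potential-w r)
                        of λ { (s≤s ()) }

    ¬reach₂-A : ∀ u → block (toℕ u) ≡ sideA → toℕ u ≢ 0 → ¬ T (reach G 2 w u)
    ¬reach₂-A u e u≢0 r = case subst (_≤ 2) (potential-A u e u≢0) (lipschitz-≤-reach potential lipschitz 2 w u potential-w r)
                            of λ { (s≤s (s≤s ())) }

    leaf-hub : T (adj G w hub)
    leaf-hub = flip hub w (hub-adj w w-leaf λ ())

    closer-to-hub : ∀ v → block (toℕ v) ≡ sideB → T (strictlyCloser G w hub v)
    closer-to-hub v e = strictlyCloser-intro w hub v (<-trans (s≤s (s≤s z≤n)) 4<n) (reach-edge 0 w hub leaf-hub) (¬reach₁-B v e)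

    closer-to-B : ∀ u v → block (toℕ u) ≡ sideA → toℕ u ≢ 0 → block (toℕ v) ≡ sideB → T (strictlyCloser G w v u)
    closer-to-B u v eu u≢0 ev = strictlyCloser-intro w v u (<-trans (s≤s (s≤s (s≤s z≤n))) 4<n)
      (reach-path₂ w hub v leaf-hub (hub-adj v ev λ ())) (¬reach₂-A u eu u≢0)

  adj-A-B : ∀ u v → block (toℕ u) ≡ sideA → block (toℕ v) ≡ sideB → T (adj G u v)
  adj-A-B u v eu ev = subst₂ (λ b c → T (blockAdj b c _ _)) (sym eu) (sym ev) tt

  A<B : ∀ {a b} → block a ≡ sideA → block b ≡ sideB → a < b
  A<B eu ev with viewOf eu | viewOf ev
  ... | inSideA a<t | inSideB t≤b _ = <-≤-trans a<t t≤b

  -- Every leaf is strictly closer to the hub than to side B, and to side B than to the rest of side A.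
  edgeTerm-A-B : ∀ u v → block (toℕ u) ≡ sideA → block (toℕ v) ≡ sideB → edgeTerm G u v ≡ pendents
  edgeTerm-A-B u v eu ev = trans (edgeTerm-≡ u v (adj-A-B u v eu ev) (A<B eu ev)) (gap u eu)
    where
      gap : ∀ u → block (toℕ u) ≡ sideA → ∣ ℓ G u v - ℓ G v u ∣ ≡ pendents
      gap fzero    _  = ∣ℓ-ℓ∣≡pendents hub v λ w p → FromLeaf.closer-to-hub w (pendent⇒leaf w p) v ev
      gap (fsuc u) eu = trans (∣-∣-comm (ℓ G (fsuc u) v) (ℓ G v (fsuc u)))
        (∣ℓ-ℓ∣≡pendents v (fsuc u) λ w p → FromLeaf.closer-to-B w (pendent⇒leaf w p) (fsuc u) v eu (λ ()) ev)

  blockCount : (Block → Bool) → ℕ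
  blockCount p = ∑[ u < suc m ] [ p (block (toℕ u)) ]

  t≤blockCount : ∀ p s → s + t ≤ suc m → (∀ i → s ≤ i → i < s + t → T (p (block i))) → t ≤ blockCount p
  t≤blockCount p s s+t≤n h =
    ∑-interval (suc m) s t (λ i → [ p (block i) ]) s+t≤n (λ i s≤i i<s+t → T⇒1≤[] (h i s≤i i<s+t))
    where
      T⇒1≤[] : ∀ {b} → T b → 1 ≤ [ b ]
      T⇒1≤[] {true} _ = ≤-refl

  t≤#A : t ≤ blockCount isSideA
  t≤#A = t≤blockCount isSideA 0 (≤-trans (m≤m+n t t) 2t≤n) λ i _ i<t → subst (T ∘ isSideA) (sym (block-A i<t)) tt

  t≤#B : t ≤ blockCount isSideB
  t≤#B = t≤blockCount isSideB t 2t≤n λ i t≤i i<2t → subst (T ∘ isSideB) (sym (block-B t≤i i<2t)) tt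

  t≤pendents : t ≤ pendents
  t≤pendents = subst (t ≤_) (sym pendents≡#leaves)
    (t≤blockCount isLeaf (t + t) 3t≤n λ i 2t≤i _ → subst (T ∘ isLeaf) (sym (block-leaf 2t≤i)) tt)
    where
      pendents≡#leaves : pendents ≡ blockCount isLeaf
      pendents≡#leaves = trans (countV-∑ (isPendent G)) (sum-cong-≗ {suc m} (cong [_] ∘ isPendent≡isLeaf))

  t³≤MoT : t * t * t ≤ MoT G
  t³≤MoT = begin
    t * t * t                                                   ≤⟨ *-mono-≤ (*-mono-≤ t≤#A t≤#B) t≤pendents ⟩
    blockCount isSideA * blockCount isSideB * pendents           ≡⟨ *-comm _ pendents ⟩
    pendents * (blockCount isSideA * blockCount isSideB)         ≡⟨ cong (pendents *_) (∑₂-product inA inB) ⟨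
    pendents * ∑₂ (λ u v → inA u * inB v)                       ≡⟨ ∑₂-scale pendents (λ u v → inA u * inB v) ⟨
    ∑₂ (λ u v → pendents * (inA u * inB v))                     ≤⟨ ∑₂-mono-≤ A-B-edges ⟩
    ∑₂ (edgeTerm G)                                             ≡⟨ MoT-∑₂ ⟨
    MoT G                                                       ∎
    where
      open ≤-Reasoning
      inA inB : Fin (suc m) → ℕ
      inA u = [ isSideA (block (toℕ u)) ]
      inB v = [ isSideB (block (toℕ v)) ]

      A-B-edges : ∀ u v → pendents * (inA u * inB v) ≤ edgeTerm G u v
      A-B-edges u v = byBlocks (block (toℕ u)) (block (toℕ v)) refl refl
        where
          none : pendents * 0 ≤ edgeTerm G u v
          none = subst (_≤ edgeTerm G u v) (sym (*-zeroʳ pendents)) z≤n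
          byBlocks : ∀ b c → block (toℕ u) ≡ b → block (toℕ v) ≡ c →
            pendents * ([ isSideA b ] * [ isSideB c ]) ≤ edgeTerm G u v
          byBlocks sideA sideB eu ev = ≤-reflexive (trans (*-identityʳ pendents) (sym (edgeTerm-A-B u v eu ev)))
          byBlocks sideA sideA _ _ = none
          byBlocks sideA leaf  _ _ = none
          byBlocks sideB _     _ _ = none
          byBlocks leaf  _     _ _ = none

mainTheorem4 : ∀ (k : ℕ) → Σ ℕ λ N → ∀ (n : ℕ) → n ≥ N →
    ((G : Graph n) → Connected G → Bipartite G →
      27 * suc k * MoT G ≤ (2 + k) * n ^ 3)
    × Σ (Graph n) (λ G → Connected G × Bipartite G ×
      (k * n ^ 3 ≤ 27 * suc k * MoT G))
mainTheorem4 k = 27 * suc k , λ n n-large → upper n n-large , lower n n-large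
  where
    upper : ∀ n → n ≥ 27 * suc k → (G : Graph n) → Connected G → Bipartite G →
      27 * suc k * MoT G ≤ (2 + k) * n ^ 3
    upper n n-large G _ bipartite =
      27[k+1]M≤[k+2]n³ k n (MoT G) n-large (UpperBound.27MoT≤27n²+n³ G bipartite)

    lower : ∀ n → n ≥ 27 * suc k → Σ (Graph n) (λ G → Connected G × Bipartite G ×
      (k * n ^ 3 ≤ 27 * suc k * MoT G))
    lower zero    ()
    lower (suc m) n-large = G , connected , bipartite ,
      ≤-trans (kn³≤27[k+1]t³ k (suc m) t n-large n≤2+3t) (*-monoʳ-≤ (27 * suc k) t³≤MoT)
      where
        t : ℕ
        t = suc m / 3
        n≤2+3t : suc m ≤ 2 + 3 * t
        n≤2+3t = n≤2+3⌊n/3⌋ (suc m)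
        2≤t : 2 ≤ t
        2≤t = ≤-trans (≤-trans (m≤m+n 2 7) (*-monoʳ-≤ 9 (s≤s z≤n))) (9[k+1]≤t k t (≤-trans n-large n≤2+3t))
        open Construction t m 2≤t (3⌊n/3⌋≤n (suc m))
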